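{- Let $\mathcal{M}=\langle W,R_1,W^2,V\rangle$ be a model (i.e., $R_2=W^2$). For any $\langle\mathcal{M},S\rangle\in\mathfrak{M}$ and any $\varphi\in\mathcal{L}_{\Diamond_L\langle+\rangle}$, we have $\mathcal{M},S\models\varphi\Leftrightarrow\langle W,R_1,V\rangle,e(S)\models\varphi^\star$, where $\varphi^\star$ is the bridge modal logic formula obtained by replacing every occurrence of $\Diamond_L$ in $\varphi$ with the basic diamond $\Diamond$.
   Context: Fix a countable set $\mathbf{P}$ of atoms. The language $\mathcal{L}$ of SLL is $\varphi::=p\mid\neg\varphi\mid(\varphi\land\varphi)\mid\Diamond_L\varphi\mid\langle-\rangle_1\varphi\mid\langle-\rangle_2\varphi\mid\langle+\rangle\varphi$ ($\Diamond_L$ is the learner-move modality, drawn as a black diamond in the paper); $\mathcal{L}_{\Diamond_L\langle+\rangle}$ is the fragment whose only modalities are $\Diamond_L$ and $\langle+\rangle$. A model is $\mathcal{M}=\langle W,R_1,R_2,V\rangle$ with $W\neq\emptyset$, $R_1,R_2\subseteq W^2$, $V:\mathbf{P}\to2^W$. For a finite non-empty sequence $S$ of worlds, $e(S)$ is its last element, $Set(S)$ the set of pairs of consecutive elements, $S;v$ the extension of $S$ by $v$. A pointed model $\langle\mathcal{M},S\rangle$ requires $Set(S)\subseteq R_1$; $\mathfrak{M}$ is the class of pointed models. $\mathcal{M}\oplus\langle v,v'\rangle=\langle W,R_1\cup\{\langle v,v'\rangle\},R_2,V\rangle$. Semantics: $\mathcal{M},S\models p$ iff $e(S)\in V(p)$;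 Booleans as usual; $\mathcal{M},S\models\Diamond_L\varphi$ iff there is $v$ with $R_1e(S)v$ and $\mathcal{M},S;v\models\varphi$; $\mathcal{M},S\models\langle+\rangle\varphi$ iff there is $\langle v,v'\rangle\in R_2\setminus R_1$ with $\mathcal{M}\oplus\langle v,v'\rangle,S\models\varphi$. Bridge modal logic (BML) is basic modal logic plus the bridge operator: on a Kripke model $\langle W,R,V\rangle$, $\langle+\rangle\psi$ holds at $w$ iff there are $v,v'\in W$ with $\langle v,v'\rangle\notin R$ and $\langle W,R\cup\{\langle v,v'\rangle\},V\rangle,w\models\psi$. -}

module Defs where

open import Data.Nat using (ℕ)
open import Data.Product using (Σ; ∃; _×_; _,_)
open import Data.Sum using (_⊎_)
open import Data.Unit using (⊤)
open import Relation.Nullary using (¬_)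
open import Relation.Binary.PropositionalEquality using (_≡_)

Atom : Set
Atom = ℕ

-- Formulas of the fragment L_{◆⟨+⟩} of SLL (only modalities ◆ = learner move and ⟨+⟩).
data FormL : Set where
  atom : Atom → FormL
  ¬L_  : FormL → FormL
  _∧L_ : FormL → FormL → FormL
  ◆_   : FormL → FormL
  ⟨+⟩L_ : FormL → FormL

data FormB : Set where
  atom : Atom → FormB
  ¬B_  : FormB → FormB
  _∧B_ : FormB → FormB → FormB
  ◇_   : FormB → FormB
  ⟨+⟩B_ : FormB → FormB

_⋆ : FormL → FormB
atom p ⋆ = atom p
(¬L φ) ⋆ = ¬B (φ ⋆)
(φ ∧L ψ) ⋆ = (φ ⋆) ∧B (ψ ⋆)
(◆ φ) ⋆ = ◇ (φ ⋆)
(⟨+⟩L φ) ⋆ = ⟨+⟩B (φ ⋆)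

Rel : Set → Set₁
Rel W = W → W → Set

record SLLModel : Set₁ where
  constructor sllModel
  field
    W     : Set
    inhab : W
    R₁    : Rel W
    R₂    : Rel W
    V     : Atom → W → Set

record KModel : Set₁ where
  constructor kModel
  field
    W     : Set
    inhab : W
    R     : Rel W
    V     : Atom → W → Set

_∪⟨_,_⟩ : {W : Set} → Rel W → W → W → Rel W
(R ∪⟨ v , v' ⟩) x y = R x y ⊎ (x ≡ v × y ≡ v')

data Seq (W : Set) : Set where
  [_] : W → Seq W
  _︔_ : Seq W → W → Seq W

e : {W : Set} → Seq W → W
e [ w ] = w
e (S ︔ v) = v

-- Set(S) ⊆ R : every pair of consecutive elements lies in R.
SetSub : {W : Set} → Seq W → Rel W → Set
SetSub [ w ] R = ⊤
SetSub (S ︔ v) R = SetSub S R × R (e S) v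

_⊕⟨_,_⟩ : (M : SLLModel) → SLLModel.W M → SLLModel.W M → SLLModel
M ⊕⟨ v , v' ⟩ = sllModel W inhab (R₁ ∪⟨ v , v' ⟩) R₂ V
  where open SLLModel M

_,_⊨L_ : (M : SLLModel) → Seq (SLLModel.W M) → FormL → Set
M , S ⊨L atom p = SLLModel.V M p (e S)
M , S ⊨L (¬L φ) = ¬ (M , S ⊨L φ)
M , S ⊨L (φ ∧L ψ) = (M , S ⊨L φ) × (M , S ⊨L ψ)
M , S ⊨L (◆ φ) = Σ (SLLModel.W M) λ v → SLLModel.R₁ M (e S) v × (M , (S ︔ v) ⊨L φ)
M , S ⊨L (⟨+⟩L φ) = Σ (SLLModel.W M) λ v → Σ (SLLModel.W M) λ v' →
  (SLLModel.R₂ M v v' × ¬ SLLModel.R₁ M v v') × ((M ⊕⟨ v , v' ⟩) , S ⊨L φ)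

_,_⊨B_ : (M : KModel) → KModel.W M → FormB → Set
M , w ⊨B atom p = KModel.V M p w
M , w ⊨B (¬B φ) = ¬ (M , w ⊨B φ)
M , w ⊨B (φ ∧B ψ) = (M , w ⊨B φ) × (M , w ⊨B ψ)
M , w ⊨B (◇ φ) = Σ (KModel.W M) λ v → KModel.R M w v × (M , v ⊨B φ)
M , w ⊨B (⟨+⟩B φ) = Σ (KModel.W M) λ v → Σ (KModel.W M) λ v' →
  ¬ KModel.R M v v' × (kModel (KModel.W M) (KModel.inhab M) (KModel.R M ∪⟨ v , v' ⟩) (KModel.V M) , w ⊨B φ)

Full : (W : Set) → Rel W
Full W _ _ = ⊤

module Submission where

open import Defs
open import Data.Product using (Σ; _×_; _,_; map₂)
open import Data.Product.Function.NonDependent.Propositional using (_×-⇔_)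
open import Data.Unit using (tt)
open import Function using (_⇔_; mk⇔; Equivalence)
open import Function.Related.TypeIsomorphisms using (¬-cong-⇔)
open import Function.Construct.Identity using (⇔-id)

-- With R₂ = W² the side condition R₂ v v' of ⟨+⟩ is trivial, so the SLL clause for ⟨+⟩
-- is the bridge clause, and ◆ is the basic diamond read at the last world of S.

Σ-cong-⇔ : {A : Set} {P Q : A → Set} → (∀ x → P x ⇔ Q x) → Σ A P ⇔ Σ A Q
Σ-cong-⇔ P⇔Q = mk⇔ (map₂ (Equivalence.to (P⇔Q _))) (map₂ (Equivalence.from (P⇔Q _)))

⊨L⇔⊨B⋆ : (W : Set) (w₀ : W) (V : Atom → W → Set) (R : Rel W) (S : Seq W) (φ : FormL) →
  (sllModel W w₀ R (Full W) V , S ⊨L φ) ⇔ (kModel W w₀ R V , e S ⊨B (φ ⋆))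
⊨L⇔⊨B⋆ W w₀ V R S (atom p) = ⇔-id _
⊨L⇔⊨B⋆ W w₀ V R S (¬L φ) = ¬-cong-⇔ (⊨L⇔⊨B⋆ W w₀ V R S φ)
⊨L⇔⊨B⋆ W w₀ V R S (φ ∧L ψ) = ⊨L⇔⊨B⋆ W w₀ V R S φ ×-⇔ ⊨L⇔⊨B⋆ W w₀ V R S ψ
⊨L⇔⊨B⋆ W w₀ V R S (◆ φ) =
  Σ-cong-⇔ λ v → ⇔-id _ ×-⇔ ⊨L⇔⊨B⋆ W w₀ V R (S ︔ v) φ
⊨L⇔⊨B⋆ W w₀ V R S (⟨+⟩L φ) =
  Σ-cong-⇔ λ v → Σ-cong-⇔ λ v' →
    mk⇔ (λ { (_ , ¬Rvv') → ¬Rvv' }) (tt ,_) ×-⇔ ⊨L⇔⊨B⋆ W w₀ V (R ∪⟨ v , v' ⟩) S φ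

proposition3 : (W : Set) (w₀ : W) (R₁ : Rel W) (V : Atom → W → Set)
    (S : Seq W) → SetSub S R₁ → (φ : FormL) →
    ((sllModel W w₀ R₁ (Full W) V , S ⊨L φ) → (kModel W w₀ R₁ V , e S ⊨B (φ ⋆)))
    × ((kModel W w₀ R₁ V , e S ⊨B (φ ⋆)) → (sllModel W w₀ R₁ (Full W) V , S ⊨L φ))
proposition3 W w₀ R₁ V S _ φ =
  Equivalence.to (⊨L⇔⊨B⋆ W w₀ V R₁ S φ) , Equivalence.from (⊨L⇔⊨B⋆ W w₀ V R₁ S φ)
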